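{- Let $T$ be a finite rooted labelled tree with labelling $\ell: V(T)\to\mathbb{N}_{\ge 1}$. For every vertex $v$ of $T$, the polynomial $C_v(x)$ (defined in the context) is irreducible over $\mathbb{Q}$.
   Context: For $i\ge 1$, $p_i$ denotes the $i$-th prime number. A rooted labelled tree is a rooted tree $T$ together with a label $\ell(v)\in\mathbb{N}_{\ge1}$ for each vertex $v$. For a vertex $v$, $T_v$ is the subtree rooted at $v$ (consisting of $v$ and its descendants) and $n_v$ is its number of vertices. Define inductively: $C_v(x) = x + p_{\ell(v)}$ if $v$ is a leaf, and $C_v(x) = x^{n_v} + p_{\ell(v)}\, x \prod_{u \text{ child of } v} C_u(x) + p_{\ell(v)}$ if $v$ is an internal vertex. -}

module Defs where

open import Data.Nat as ℕ using (ℕ; zero; suc; _≤_)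
open import Data.Nat.Primality using (Prime; prime?)

open import Data.Integer using (+_)
open import Data.Rational as ℚ using (ℚ; 0ℚ; 1ℚ)
open import Data.List using (List; []; _∷_; map)
open import Data.List.Relation.Unary.Any using (Any)
open import Data.List.Relation.Unary.All using (All)
open import Data.Product using (∃; _×_)
open import Data.Sum using (_⊎_)
open import Relation.Nullary using (¬_; yes; no)
open import Relation.Binary.PropositionalEquality using (_≡_)

-- The i-th prime p_i (1-indexed: nthPrime 1 = 2, nthPrime 2 = 3, ...).

search : ℕ → ℕ → ℕ
search zero    c = c
search (suc f) c with prime? c
... | yes _ = c
... | no  _ = search f (suc c)

-- smallest prime > n (it lies in (n, n!+1], covered by the search window)
nextPrime : ℕ → ℕ
nextPrime n = search (n ℕ.!) (suc n)

nthPrime : ℕ → ℕ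
nthPrime zero    = 0           -- unused (p_0 is not defined in the paper)
nthPrime (suc i) = nextPrime (nthPrime i)

-- Polynomials over ℚ as coefficient lists (constant coefficient first).

Poly : Set
Poly = List ℚ

coeff : Poly → ℕ → ℚ
coeff []      _       = 0ℚ
coeff (a ∷ p) zero    = a
coeff (a ∷ p) (suc n) = coeff p n

infixl 6 _⊕_
infixl 7 _⊗_

_⊕_ : Poly → Poly → Poly
[]      ⊕ q       = q
(a ∷ p) ⊕ []      = a ∷ p
(a ∷ p) ⊕ (b ∷ q) = (a ℚ.+ b) ∷ (p ⊕ q)

scale : ℚ → Poly → Poly
scale a p = map (a ℚ.*_) p

_⊗_ : Poly → Poly → Poly
[]      ⊗ q = []
(a ∷ p) ⊗ q = scale a q ⊕ (0ℚ ∷ (p ⊗ q))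

const : ℚ → Poly
const c = c ∷ []

X : Poly
X = 0ℚ ∷ 1ℚ ∷ []

Xpow : ℕ → Poly
Xpow zero    = 1ℚ ∷ []
Xpow (suc n) = 0ℚ ∷ Xpow n

-- equality of polynomials (coefficientwise, so trailing zeros are irrelevant)
_≈ₚ_ : Poly → Poly → Set
p ≈ₚ q = ∀ n → coeff p n ≡ coeff q n

IsConstant : Poly → Set
IsConstant p = ∀ n → coeff p (suc n) ≡ 0ℚ

Irreducible : Poly → Set
Irreducible p = (¬ IsConstant p) ×
  (∀ f g → (f ⊗ g) ≈ₚ p → IsConstant f ⊎ IsConstant g)

data Tree : Set where
  node : ℕ → List Tree → Tree

label : Tree → ℕ
label (node l _) = l

data LabelsPos : Tree → Set where
  node : ∀ {l cs} → 1 ≤ l → All LabelsPos cs → LabelsPos (node l cs)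

-- S ⊑ T : S is the subtree T_v rooted at some vertex v of T
data _⊑_ (S : Tree) : Tree → Set where
  here  : S ⊑ S
  there : ∀ {l cs} → Any (S ⊑_) cs → S ⊑ node l cs

mutual
  size : Tree → ℕ
  size (node _ cs) = suc (sizes cs)

  sizes : List Tree → ℕ
  sizes []       = 0
  sizes (c ∷ cs) = size c ℕ.+ sizes cs

pℚ : ℕ → ℚ
pℚ l = + (nthPrime l) ℚ./ 1

mutual
  -- C_v(x) for the vertex v that is the root of the given (sub)tree
  C : Tree → Poly
  C (node l [])       = X ⊕ const (pℚ l)
  C (node l (c ∷ cs)) =
    Xpow (size (node l (c ∷ cs))) ⊕ scale (pℚ l) (X ⊗ prodC (c ∷ cs)) ⊕ const (pℚ l)

  prodC : List Tree → Poly
  prodC []       = 1ℚ ∷ []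
  prodC (c ∷ cs) = C c ⊗ prodC cs

-- Each C_v is an Eisenstein polynomial at p = p_ℓ(v). A leaf gives x + p, and at an
-- internal vertex C_v = xⁿ + p·x·Π + p with deg (x·Π) ≤ n, so its constant term is p,
-- the coefficients below xⁿ are multiples of p and the leading one is 1 + p·(…).
-- Eisenstein's criterion is proved in ℤ[x]: in a factorisation F G = H, the lowest
-- coefficients of F and G prime to p and their leading coefficients are pinned down by
-- those of H. A factorisation over ℚ becomes F G = D·H in ℤ[x] once denominators are
-- cleared, and Gauss's lemma moves the factors p of D into F or G one at a time.
module Submission where

open import Defs

open import Data.Empty using (⊥-elim)
open import Data.Integer as ℤ using (ℤ; +_; 0ℤ)
import Data.Integer.Properties as ℤ
open import Data.Integer.Divisibility.Signed
  using (_∣_; divides; _∣?_; ∣⇒∣ᵤ; ∣ᵤ⇒∣; ∣-refl; ∣-trans; ∣m∣n⇒∣m+n; ∣m+n∣m⇒∣n; ∣m+n∣n⇒∣m;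
         ∣m⇒∣m*n; ∣n⇒∣m*n; *-monoˡ-∣; *-monoʳ-∣; *-cancelʳ-∣)
open import Data.List using (List; []; _∷_; map)
open import Data.List.Relation.Unary.All using (All; _∷_)
open import Data.List.Relation.Unary.Any using (Any; here; there)
open import Data.Nat as ℕ using (ℕ; zero; suc; _≤_; _<_; z≤n; s≤s; _∸_; _!)
import Data.Nat.Coprimality as Coprime
import Data.Nat.Divisibility as ℕ∣
open import Data.Nat.Induction using (<-wellFounded)
open import Data.Nat.ListAction using (product)
import Data.Nat.Properties as ℕ
open import Data.Nat.Primality
  using (Prime; prime?; prime[2]; ¬prime[1]; euclidsLemma; prime⇒nonZero; prime⇒nonTrivial)
open import Data.Nat.Primality.Factorisation using (factorise)
open import Data.Product using (∃; ∃₂; ∃-syntax; _×_; _,_)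
open import Data.Rational as ℚ using (ℚ; mkℚ; 0ℚ; 1ℚ; ↥_; ↧_)
open import Data.Rational.Literals using (fromℤ)
import Data.Rational.Properties as ℚ
import Data.Rational.Unnormalised as ℚᵘ
import Data.Rational.Unnormalised.Properties as ℚᵘ
open import Data.Sum using (_⊎_; inj₁; inj₂; [_,_])
import Data.Sum as Sum
open import Function using (_∘_)
open import Induction.WellFounded using (Acc; acc)
open import Relation.Binary.Definitions using (tri<; tri≈; tri>)
open import Relation.Binary.PropositionalEquality
  using (_≡_; _≢_; refl; sym; trans; cong; cong₂; subst; module ≡-Reasoning)
open import Relation.Nullary using (¬_; yes; no)

open ≡-Reasoning

-- The primes p_i

search-prime : ∀ fuel c {q} → Prime q → c ≤ q → q < c ℕ.+ fuel → Prime (search fuel c)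
search-prime zero       c {q} _       c≤q q<c+0 = ⊥-elim (ℕ.<⇒≱ (subst (q <_) (ℕ.+-identityʳ c) q<c+0) c≤q)
search-prime (suc fuel) c {q} q-prime c≤q q<c+1+f with prime? c
... | yes c-prime = c-prime
... | no ¬c-prime = search-prime fuel (suc c) q-prime c<q (subst (q <_) (ℕ.+-suc c fuel) q<c+1+f)
  where
  c<q : c < q
  c<q = ℕ.≤∧≢⇒< c≤q (λ { refl → ¬c-prime q-prime })

prime-factor : ∀ n → 2 ≤ n → ∃[ q ] Prime q × q ℕ∣.∣ n
prime-factor n@(suc _) 2≤n with factorise n
... | record { factors = [] ; isFactorisation = n≡1 } = ⊥-elim (ℕ.<⇒≢ 2≤n (sym n≡1))
... | record { factors = q ∷ qs ; isFactorisation = n≡q*Πqs ; factorsPrime = q-prime ∷ _ } =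
  q , q-prime , subst (q ℕ∣.∣_) (sym n≡q*Πqs) (ℕ∣.m∣m*n (product qs))

m∣n! : ∀ {m n} → .{{ℕ.NonZero m}} → m ≤ n → m ℕ∣.∣ n !
m∣n! {suc m-1} m≤n = ℕ∣.∣-trans (ℕ∣.m∣m*n (m-1 !)) (ℕ∣.m≤n⇒m!∣n! m≤n)

-- A prime factor q of n! + 1 satisfies n < q ≤ n! + 1 < n + 1 + n!, so it lies in the
-- window searched by nextPrime.
nextPrime-prime : ∀ {n} → 1 ≤ n → Prime (nextPrime n)
nextPrime-prime {n} 1≤n with prime-factor (n ! ℕ.+ 1) (ℕ.+-monoˡ-≤ 1 (ℕ.1≤n! n))
... | q , q-prime , q∣n!+1 = search-prime (n !) (suc n) q-prime n<q q<1+n+n!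
  where
  n<q : n < q
  n<q = ℕ.≰⇒> λ q≤n → ¬prime[1]
    (subst Prime (ℕ∣.∣1⇒≡1 (ℕ∣.∣m+n∣m⇒∣n q∣n!+1 (m∣n! {{prime⇒nonZero q-prime}} q≤n))) q-prime)
  q<1+n+n! : q < suc n ℕ.+ n !
  q<1+n+n! = s≤s (ℕ.≤-trans (ℕ∣.∣⇒≤ {{ℕ.>-nonZero (ℕ.m≤n+m 1 (n !))}} q∣n!+1)
                  (ℕ.≤-trans (ℕ.+-monoʳ-≤ (n !) 1≤n) (ℕ.≤-reflexive (ℕ.+-comm (n !) n))))

nthPrime-prime : ∀ i → Prime (nthPrime (suc i))
nthPrime-prime zero    = prime[2]
nthPrime-prime (suc i) = nextPrime-prime (ℕ.>-nonZero⁻¹ _ {{prime⇒nonZero (nthPrime-prime i)}})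

-- Rational polynomials

fromℤ-injective : ∀ {a b} → fromℤ a ≡ fromℤ b → a ≡ b
fromℤ-injective = cong ↥_

fromℤ-+ : ∀ a b → fromℤ (a ℤ.+ b) ≡ fromℤ a ℚ.+ fromℤ b
fromℤ-+ a b = ℚ.toℚᵘ-injective (ℚᵘ.≃-trans (ℚᵘ.*≡* eq) (ℚᵘ.≃-sym (ℚ.toℚᵘ-homo-+ (fromℤ a) (fromℤ b))))
  where
  eq : (a ℤ.+ b) ℤ.* + 1 ≡ (a ℤ.* + 1 ℤ.+ b ℤ.* + 1) ℤ.* + 1
  eq rewrite ℤ.*-identityʳ a | ℤ.*-identityʳ b = refl

fromℤ-* : ∀ a b → fromℤ (a ℤ.* b) ≡ fromℤ a ℚ.* fromℤ b
fromℤ-* a b = ℚ.toℚᵘ-injective (ℚᵘ.≃-sym (ℚ.toℚᵘ-homo-* (fromℤ a) (fromℤ b)))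

fromℤ-pos-* : ∀ m n → fromℤ (+ (m ℕ.* n)) ≡ fromℤ (+ m) ℚ.* fromℤ (+ n)
fromℤ-pos-* m n = trans (cong fromℤ (ℤ.pos-* m n)) (fromℤ-* (+ m) (+ n))

fromℤ-↧*≡↥ : ∀ q → fromℤ (↧ q) ℚ.* q ≡ fromℤ (↥ q)
fromℤ-↧*≡↥ q@(mkℚ n d-1 _) =
  ℚ.toℚᵘ-injective (ℚᵘ.≃-trans (ℚ.toℚᵘ-homo-* (fromℤ (↧ q)) q) (ℚᵘ.*≡* eq))
  where
  eq : (↧ q ℤ.* n) ℤ.* + 1 ≡ n ℤ.* + suc (d-1 ℕ.+ 0)
  eq rewrite ℤ.*-identityʳ (↧ q ℤ.* n) | ℕ.+-identityʳ d-1 = ℤ.*-comm (↧ q) n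

pℚ≡fromℤ : ∀ l → pℚ l ≡ fromℤ (+ nthPrime l)
pℚ≡fromℤ l = ℚ.normalize-coprime (Coprime.sym (Coprime.1-coprimeTo (nthPrime l)))

a*x≡0⇒x≡0 : ∀ a .{{_ : ℚ.NonZero a}} {x} → a ℚ.* x ≡ 0ℚ → x ≡ 0ℚ
a*x≡0⇒x≡0 a {x} ax≡0 = begin
  x                     ≡⟨ ℚ.*-identityˡ x ⟨
  1ℚ ℚ.* x              ≡⟨ cong (ℚ._* x) (ℚ.*-inverseˡ a) ⟨
  ℚ.1/ a ℚ.* a ℚ.* x    ≡⟨ ℚ.*-assoc (ℚ.1/ a) a x ⟩
  ℚ.1/ a ℚ.* (a ℚ.* x)  ≡⟨ cong (ℚ.1/ a ℚ.*_) ax≡0 ⟩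
  ℚ.1/ a ℚ.* 0ℚ         ≡⟨ ℚ.*-zeroʳ (ℚ.1/ a) ⟩
  0ℚ                    ∎

coeff-scale : ∀ a p n → coeff (scale a p) n ≡ a ℚ.* coeff p n
coeff-scale a []      n       = sym (ℚ.*-zeroʳ a)
coeff-scale a (b ∷ p) zero    = refl
coeff-scale a (b ∷ p) (suc n) = coeff-scale a p n

scale-⊕ : ∀ a p q → scale a (p ⊕ q) ≡ scale a p ⊕ scale a q
scale-⊕ a []      q       = refl
scale-⊕ a (b ∷ p) []      = refl
scale-⊕ a (b ∷ p) (c ∷ q) = cong₂ _∷_ (ℚ.*-distribˡ-+ a b c) (scale-⊕ a p q)

scale-scale : ∀ a b p → scale a (scale b p) ≡ scale (a ℚ.* b) p
scale-scale a b []      = refl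
scale-scale a b (c ∷ p) = cong₂ _∷_ (sym (ℚ.*-assoc a b c)) (scale-scale a b p)

scale-⊗ˡ : ∀ a p q → scale a p ⊗ q ≡ scale a (p ⊗ q)
scale-⊗ˡ a []      q = refl
scale-⊗ˡ a (b ∷ p) q = begin
  scale (a ℚ.* b) q ⊕ (0ℚ ∷ scale a p ⊗ q)
    ≡⟨ cong₂ (λ r s → r ⊕ (s ∷ scale a p ⊗ q)) (sym (scale-scale a b q)) (sym (ℚ.*-zeroʳ a)) ⟩
  scale a (scale b q) ⊕ (a ℚ.* 0ℚ ∷ scale a p ⊗ q)
    ≡⟨ cong (λ r → scale a (scale b q) ⊕ (a ℚ.* 0ℚ ∷ r)) (scale-⊗ˡ a p q) ⟩
  scale a (scale b q) ⊕ scale a (0ℚ ∷ p ⊗ q)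
    ≡⟨ scale-⊕ a (scale b q) (0ℚ ∷ p ⊗ q) ⟨
  scale a (scale b q ⊕ (0ℚ ∷ p ⊗ q)) ∎

⊗-scaleʳ : ∀ a p q → p ⊗ scale a q ≡ scale a (p ⊗ q)
⊗-scaleʳ a []      q = refl
⊗-scaleʳ a (b ∷ p) q = begin
  scale b (scale a q) ⊕ (0ℚ ∷ p ⊗ scale a q)
    ≡⟨ cong₂ (λ r s → r ⊕ (s ∷ p ⊗ scale a q)) scale-swap (sym (ℚ.*-zeroʳ a)) ⟩
  scale a (scale b q) ⊕ (a ℚ.* 0ℚ ∷ p ⊗ scale a q)
    ≡⟨ cong (λ r → scale a (scale b q) ⊕ (a ℚ.* 0ℚ ∷ r)) (⊗-scaleʳ a p q) ⟩
  scale a (scale b q) ⊕ scale a (0ℚ ∷ p ⊗ q)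
    ≡⟨ scale-⊕ a (scale b q) (0ℚ ∷ p ⊗ q) ⟨
  scale a (scale b q ⊕ (0ℚ ∷ p ⊗ q)) ∎
  where
  scale-swap : scale b (scale a q) ≡ scale a (scale b q)
  scale-swap = begin
    scale b (scale a q)  ≡⟨ scale-scale b a q ⟩
    scale (b ℚ.* a) q    ≡⟨ cong (λ c → scale c q) (ℚ.*-comm b a) ⟩
    scale (a ℚ.* b) q    ≡⟨ scale-scale a b q ⟨
    scale a (scale b q)  ∎

scale-⊗-scale : ∀ a b p q → scale a p ⊗ scale b q ≡ scale (a ℚ.* b) (p ⊗ q)
scale-⊗-scale a b p q = begin
  scale a p ⊗ scale b q     ≡⟨ scale-⊗ˡ a p (scale b q) ⟩
  scale a (p ⊗ scale b q)   ≡⟨ cong (scale a) (⊗-scaleʳ b p q) ⟩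
  scale a (scale b (p ⊗ q)) ≡⟨ scale-scale a b (p ⊗ q) ⟩
  scale (a ℚ.* b) (p ⊗ q)   ∎

-- Integer polynomials

Polyᶻ : Set
Polyᶻ = List ℤ

coeffᶻ : Polyᶻ → ℕ → ℤ
coeffᶻ []      _       = + 0
coeffᶻ (a ∷ P) zero    = a
coeffᶻ (a ∷ P) (suc n) = coeffᶻ P n

infix  4 _≈ᶻ_
infixl 6 _⊕ᶻ_
infixl 7 _⊗ᶻ_

_≈ᶻ_ : Polyᶻ → Polyᶻ → Set
P ≈ᶻ Q = ∀ n → coeffᶻ P n ≡ coeffᶻ Q n

_⊕ᶻ_ : Polyᶻ → Polyᶻ → Polyᶻ
[]      ⊕ᶻ Q       = Q
(a ∷ P) ⊕ᶻ []      = a ∷ P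
(a ∷ P) ⊕ᶻ (b ∷ Q) = (a ℤ.+ b) ∷ (P ⊕ᶻ Q)

scaleᶻ : ℤ → Polyᶻ → Polyᶻ
scaleᶻ a P = map (a ℤ.*_) P

_⊗ᶻ_ : Polyᶻ → Polyᶻ → Polyᶻ
[]      ⊗ᶻ Q = []
(a ∷ P) ⊗ᶻ Q = scaleᶻ a Q ⊕ᶻ (+ 0 ∷ P ⊗ᶻ Q)

Xᶻ : Polyᶻ
Xᶻ = + 0 ∷ + 1 ∷ []

Xpowᶻ : ℕ → Polyᶻ
Xpowᶻ zero    = + 1 ∷ []
Xpowᶻ (suc n) = + 0 ∷ Xpowᶻ n

constᶻ : ℤ → Polyᶻ
constᶻ c = c ∷ []

mutual
  Cᶻ : Tree → Polyᶻ
  Cᶻ (node l [])       = Xᶻ ⊕ᶻ constᶻ (+ nthPrime l)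
  Cᶻ (node l (c ∷ cs)) =
    Xpowᶻ (size (node l (c ∷ cs))) ⊕ᶻ scaleᶻ (+ nthPrime l) (Xᶻ ⊗ᶻ prodCᶻ (c ∷ cs)) ⊕ᶻ constᶻ (+ nthPrime l)

  prodCᶻ : List Tree → Polyᶻ
  prodCᶻ []       = + 1 ∷ []
  prodCᶻ (c ∷ cs) = Cᶻ c ⊗ᶻ prodCᶻ cs

coeff-map-fromℤ : ∀ P n → coeff (map fromℤ P) n ≡ fromℤ (coeffᶻ P n)
coeff-map-fromℤ []      n       = refl
coeff-map-fromℤ (a ∷ P) zero    = refl
coeff-map-fromℤ (a ∷ P) (suc n) = coeff-map-fromℤ P n

map-fromℤ-⊕ : ∀ P Q → map fromℤ (P ⊕ᶻ Q) ≡ map fromℤ P ⊕ map fromℤ Q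
map-fromℤ-⊕ []      Q       = refl
map-fromℤ-⊕ (a ∷ P) []      = refl
map-fromℤ-⊕ (a ∷ P) (b ∷ Q) = cong₂ _∷_ (fromℤ-+ a b) (map-fromℤ-⊕ P Q)

map-fromℤ-scale : ∀ a P → map fromℤ (scaleᶻ a P) ≡ scale (fromℤ a) (map fromℤ P)
map-fromℤ-scale a []      = refl
map-fromℤ-scale a (b ∷ P) = cong₂ _∷_ (fromℤ-* a b) (map-fromℤ-scale a P)

map-fromℤ-⊗ : ∀ P Q → map fromℤ (P ⊗ᶻ Q) ≡ map fromℤ P ⊗ map fromℤ Q
map-fromℤ-⊗ []      Q = refl
map-fromℤ-⊗ (a ∷ P) Q = begin
  map fromℤ (scaleᶻ a Q ⊕ᶻ (+ 0 ∷ P ⊗ᶻ Q))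
    ≡⟨ map-fromℤ-⊕ (scaleᶻ a Q) (+ 0 ∷ P ⊗ᶻ Q) ⟩
  map fromℤ (scaleᶻ a Q) ⊕ (0ℚ ∷ map fromℤ (P ⊗ᶻ Q))
    ≡⟨ cong₂ (λ r s → r ⊕ (0ℚ ∷ s)) (map-fromℤ-scale a Q) (map-fromℤ-⊗ P Q) ⟩
  scale (fromℤ a) (map fromℤ Q) ⊕ (0ℚ ∷ map fromℤ P ⊗ map fromℤ Q) ∎

map-fromℤ-Xpow : ∀ n → map fromℤ (Xpowᶻ n) ≡ Xpow n
map-fromℤ-Xpow zero    = refl
map-fromℤ-Xpow (suc n) = cong (0ℚ ∷_) (map-fromℤ-Xpow n)

map-fromℤ-Xpow+aXQ+a : ∀ n a Q → map fromℤ (Xpowᶻ n ⊕ᶻ scaleᶻ a (Xᶻ ⊗ᶻ Q) ⊕ᶻ constᶻ a) ≡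
                                   Xpow n ⊕ scale (fromℤ a) (X ⊗ map fromℤ Q) ⊕ const (fromℤ a)
map-fromℤ-Xpow+aXQ+a n a Q
  rewrite map-fromℤ-⊕ (Xpowᶻ n ⊕ᶻ scaleᶻ a (Xᶻ ⊗ᶻ Q)) (constᶻ a)
        | map-fromℤ-⊕ (Xpowᶻ n) (scaleᶻ a (Xᶻ ⊗ᶻ Q))
        | map-fromℤ-Xpow n
        | map-fromℤ-scale a (Xᶻ ⊗ᶻ Q)
        | map-fromℤ-⊗ Xᶻ Q
        = refl

mutual
  map-fromℤ-C : ∀ S → map fromℤ (Cᶻ S) ≡ C S
  map-fromℤ-C (node l []) =
    trans (map-fromℤ-⊕ Xᶻ (constᶻ (+ nthPrime l))) (cong (λ a → X ⊕ const a) (sym (pℚ≡fromℤ l)))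
  map-fromℤ-C (node l (c ∷ cs)) =
    trans (map-fromℤ-Xpow+aXQ+a (size (node l (c ∷ cs))) (+ nthPrime l) (prodCᶻ (c ∷ cs)))
          (cong₂ (λ a P → Xpow (size (node l (c ∷ cs))) ⊕ scale a (X ⊗ P) ⊕ const a)
                 (sym (pℚ≡fromℤ l)) (map-fromℤ-prodC (c ∷ cs)))

  map-fromℤ-prodC : ∀ cs → map fromℤ (prodCᶻ cs) ≡ prodC cs
  map-fromℤ-prodC []       = refl
  map-fromℤ-prodC (c ∷ cs) =
    trans (map-fromℤ-⊗ (Cᶻ c) (prodCᶻ cs)) (cong₂ _⊗_ (map-fromℤ-C c) (map-fromℤ-prodC cs))

∑≤ : ℕ → (ℕ → ℤ) → ℤ
∑≤ zero    f = f 0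
∑≤ (suc N) f = f 0 ℤ.+ ∑≤ N (λ k → f (suc k))

∑≤-cong : ∀ N {f g} → (∀ k → k ≤ N → f k ≡ g k) → ∑≤ N f ≡ ∑≤ N g
∑≤-cong zero    f≡g = f≡g 0 z≤n
∑≤-cong (suc N) f≡g = cong₂ ℤ._+_ (f≡g 0 z≤n) (∑≤-cong N (λ k k≤N → f≡g (suc k) (s≤s k≤N)))

∑≤-zero : ∀ N {f} → (∀ k → k ≤ N → f k ≡ 0ℤ) → ∑≤ N f ≡ 0ℤ
∑≤-zero zero    f≡0 = f≡0 0 z≤n
∑≤-zero (suc N) f≡0 = cong₂ ℤ._+_ (f≡0 0 z≤n) (∑≤-zero N (λ k k≤N → f≡0 (suc k) (s≤s k≤N)))

∑≤-single : ∀ N {f} m → m ≤ N → (∀ k → k ≤ N → k ≢ m → f k ≡ 0ℤ) → ∑≤ N f ≡ f m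
∑≤-single zero    zero    _         _      = refl
∑≤-single (suc N) {f} zero _ others =
  trans (cong (λ s → f 0 ℤ.+ s) (∑≤-zero N (λ k k≤N → others (suc k) (s≤s k≤N) (λ ()))))
        (ℤ.+-identityʳ (f 0))
∑≤-single (suc N) {f} (suc m) (s≤s m≤N) others =
  trans (cong₂ ℤ._+_ (others 0 z≤n (λ ()))
                     (∑≤-single N m m≤N (λ k k≤N k≢m → others (suc k) (s≤s k≤N) (k≢m ∘ ℕ.suc-injective))))
        (ℤ.+-identityˡ (f (suc m)))

∑≤-∣ : ∀ N {d f} → (∀ k → k ≤ N → d ∣ f k) → d ∣ ∑≤ N f
∑≤-∣ zero    d∣f = d∣f 0 z≤n
∑≤-∣ (suc N) d∣f = ∣m∣n⇒∣m+n (d∣f 0 z≤n) (∑≤-∣ N (λ k k≤N → d∣f (suc k) (s≤s k≤N)))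

∑≤-∣-single : ∀ N {d f} m → m ≤ N → (∀ k → k ≤ N → k ≢ m → d ∣ f k) → d ∣ ∑≤ N f → d ∣ f m
∑≤-∣-single zero    zero    _         _      d∣∑ = d∣∑
∑≤-∣-single (suc N) zero    _         others d∣∑ =
  ∣m+n∣n⇒∣m d∣∑ (∑≤-∣ N (λ k k≤N → others (suc k) (s≤s k≤N) (λ ())))
∑≤-∣-single (suc N) (suc m) (s≤s m≤N) others d∣∑ =
  ∑≤-∣-single N m m≤N (λ k k≤N k≢m → others (suc k) (s≤s k≤N) (k≢m ∘ ℕ.suc-injective))
    (∣m+n∣m⇒∣n d∣∑ (others 0 z≤n (λ ())))

∑≤-*ˡ : ∀ N a f → ∑≤ N (λ k → a ℤ.* f k) ≡ a ℤ.* ∑≤ N f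
∑≤-*ˡ zero    a f = refl
∑≤-*ˡ (suc N) a f =
  trans (cong (λ s → a ℤ.* f 0 ℤ.+ s) (∑≤-*ˡ N a (λ k → f (suc k)))) (sym (ℤ.*-distribˡ-+ a (f 0) _))

∑≤-snoc : ∀ N f → ∑≤ (suc N) f ≡ ∑≤ N f ℤ.+ f (suc N)
∑≤-snoc zero    f = refl
∑≤-snoc (suc N) f =
  trans (cong (λ s → f 0 ℤ.+ s) (∑≤-snoc N (λ k → f (suc k)))) (sym (ℤ.+-assoc (f 0) _ _))

∑≤-reverse : ∀ N f → ∑≤ N f ≡ ∑≤ N (λ k → f (N ∸ k))
∑≤-reverse zero    f = refl
∑≤-reverse (suc N) f = begin
  ∑≤ (suc N) f                          ≡⟨ ∑≤-snoc N f ⟩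
  ∑≤ N f ℤ.+ f (suc N)                  ≡⟨ ℤ.+-comm (∑≤ N f) (f (suc N)) ⟩
  f (suc N) ℤ.+ ∑≤ N f                  ≡⟨ cong (λ s → f (suc N) ℤ.+ s) (∑≤-reverse N f) ⟩
  f (suc N) ℤ.+ ∑≤ N (λ k → f (N ∸ k))  ∎

coeffᶻ-⊕ : ∀ P Q n → coeffᶻ (P ⊕ᶻ Q) n ≡ coeffᶻ P n ℤ.+ coeffᶻ Q n
coeffᶻ-⊕ []      Q       n       = sym (ℤ.+-identityˡ (coeffᶻ Q n))
coeffᶻ-⊕ (a ∷ P) []      n       = sym (ℤ.+-identityʳ (coeffᶻ (a ∷ P) n))
coeffᶻ-⊕ (a ∷ P) (b ∷ Q) zero    = refl
coeffᶻ-⊕ (a ∷ P) (b ∷ Q) (suc n) = coeffᶻ-⊕ P Q n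

coeffᶻ-scale : ∀ a P n → coeffᶻ (scaleᶻ a P) n ≡ a ℤ.* coeffᶻ P n
coeffᶻ-scale a []      n       = sym (ℤ.*-zeroʳ a)
coeffᶻ-scale a (b ∷ P) zero    = refl
coeffᶻ-scale a (b ∷ P) (suc n) = coeffᶻ-scale a P n

coeffᶻ-⊗ : ∀ P Q n → coeffᶻ (P ⊗ᶻ Q) n ≡ ∑≤ n (λ k → coeffᶻ P k ℤ.* coeffᶻ Q (n ∸ k))
coeffᶻ-⊗ []      Q n       = sym (∑≤-zero n (λ k _ → ℤ.*-zeroˡ (coeffᶻ Q (n ∸ k))))
coeffᶻ-⊗ (a ∷ P) Q zero    =
  trans (coeffᶻ-⊕ (scaleᶻ a Q) (+ 0 ∷ P ⊗ᶻ Q) 0) (trans (ℤ.+-identityʳ _) (coeffᶻ-scale a Q 0))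
coeffᶻ-⊗ (a ∷ P) Q (suc n) =
  trans (coeffᶻ-⊕ (scaleᶻ a Q) (+ 0 ∷ P ⊗ᶻ Q) (suc n)) (cong₂ ℤ._+_ (coeffᶻ-scale a Q (suc n)) (coeffᶻ-⊗ P Q n))

⊗ᶻ-comm : ∀ P Q → P ⊗ᶻ Q ≈ᶻ Q ⊗ᶻ P
⊗ᶻ-comm P Q n = begin
  coeffᶻ (P ⊗ᶻ Q) n                                          ≡⟨ coeffᶻ-⊗ P Q n ⟩
  ∑≤ n (λ k → coeffᶻ P k ℤ.* coeffᶻ Q (n ∸ k))               ≡⟨ ∑≤-reverse n _ ⟩
  ∑≤ n (λ k → coeffᶻ P (n ∸ k) ℤ.* coeffᶻ Q (n ∸ (n ∸ k)))   ≡⟨ ∑≤-cong n swap ⟩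
  ∑≤ n (λ k → coeffᶻ Q k ℤ.* coeffᶻ P (n ∸ k))               ≡⟨ coeffᶻ-⊗ Q P n ⟨
  coeffᶻ (Q ⊗ᶻ P) n                                          ∎
  where
  swap : ∀ k → k ≤ n → coeffᶻ P (n ∸ k) ℤ.* coeffᶻ Q (n ∸ (n ∸ k)) ≡ coeffᶻ Q k ℤ.* coeffᶻ P (n ∸ k)
  swap k k≤n = trans (cong (λ j → coeffᶻ P (n ∸ k) ℤ.* coeffᶻ Q j) (ℕ.m∸[m∸n]≡n k≤n))
                     (ℤ.*-comm (coeffᶻ P (n ∸ k)) (coeffᶻ Q k))

⊗ᶻ-≈scaleˡ : ∀ a P P′ Q → P ≈ᶻ scaleᶻ a P′ → P ⊗ᶻ Q ≈ᶻ scaleᶻ a (P′ ⊗ᶻ Q)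
⊗ᶻ-≈scaleˡ a P P′ Q P≈aP′ n = begin
  coeffᶻ (P ⊗ᶻ Q) n                                          ≡⟨ coeffᶻ-⊗ P Q n ⟩
  ∑≤ n (λ k → coeffᶻ P k ℤ.* coeffᶻ Q (n ∸ k))               ≡⟨ ∑≤-cong n (λ k _ → factor k) ⟩
  ∑≤ n (λ k → a ℤ.* (coeffᶻ P′ k ℤ.* coeffᶻ Q (n ∸ k)))      ≡⟨ ∑≤-*ˡ n a _ ⟩
  a ℤ.* ∑≤ n (λ k → coeffᶻ P′ k ℤ.* coeffᶻ Q (n ∸ k))        ≡⟨ cong (a ℤ.*_) (coeffᶻ-⊗ P′ Q n) ⟨
  a ℤ.* coeffᶻ (P′ ⊗ᶻ Q) n                                   ≡⟨ coeffᶻ-scale a (P′ ⊗ᶻ Q) n ⟨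
  coeffᶻ (scaleᶻ a (P′ ⊗ᶻ Q)) n                              ∎
  where
  factor : ∀ k → coeffᶻ P k ℤ.* coeffᶻ Q (n ∸ k) ≡ a ℤ.* (coeffᶻ P′ k ℤ.* coeffᶻ Q (n ∸ k))
  factor k = trans (cong (ℤ._* coeffᶻ Q (n ∸ k)) (trans (P≈aP′ k) (coeffᶻ-scale a P′ k)))
                   (ℤ.*-assoc a (coeffᶻ P′ k) (coeffᶻ Q (n ∸ k)))

coeffᶻ-Xpow-≢ : ∀ n k → k ≢ n → coeffᶻ (Xpowᶻ n) k ≡ 0ℤ
coeffᶻ-Xpow-≢ zero    zero    k≢n = ⊥-elim (k≢n refl)
coeffᶻ-Xpow-≢ zero    (suc k) _   = refl
coeffᶻ-Xpow-≢ (suc n) zero    _   = refl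
coeffᶻ-Xpow-≢ (suc n) (suc k) k≢n = coeffᶻ-Xpow-≢ n k (k≢n ∘ cong suc)

coeffᶻ-Xpow-≡ : ∀ n → coeffᶻ (Xpowᶻ n) n ≡ + 1
coeffᶻ-Xpow-≡ zero    = refl
coeffᶻ-Xpow-≡ (suc n) = coeffᶻ-Xpow-≡ n

coeffᶻ-X⊗-zero : ∀ Q → coeffᶻ (Xᶻ ⊗ᶻ Q) 0 ≡ 0ℤ
coeffᶻ-X⊗-zero Q = trans (coeffᶻ-⊗ Xᶻ Q 0) (ℤ.*-zeroˡ (coeffᶻ Q 0))

-- Degrees

DegreeAtMost : Polyᶻ → ℕ → Set
DegreeAtMost P d = ∀ k → d < k → coeffᶻ P k ≡ 0ℤ

record Degree (P : Polyᶻ) (d : ℕ) : Set where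
  field
    leading≢0 : coeffᶻ P d ≢ 0ℤ
    atMost    : DegreeAtMost P d

degree : ∀ P → (∀ k → coeffᶻ P k ≡ 0ℤ) ⊎ ∃ (Degree P)
degree []      = inj₁ (λ _ → refl)
degree (a ∷ P) with degree P
... | inj₂ (d , degP) = inj₂ (suc d , record { leading≢0 = Degree.leading≢0 degP ; atMost = atMost })
  where
  atMost : DegreeAtMost (a ∷ P) (suc d)
  atMost (suc k) (s≤s d<k) = Degree.atMost degP k d<k
... | inj₁ P≡0 with a ℤ.≟ 0ℤ
...   | yes refl = inj₁ λ { zero → refl ; (suc k) → P≡0 k }
...   | no  a≢0  = inj₂ (0 , record { leading≢0 = a≢0 ; atMost = λ { (suc k) _ → P≡0 k } })

degree≥ : ∀ P {i} → coeffᶻ P i ≢ 0ℤ → ∃[ d ] i ≤ d × Degree P d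
degree≥ P Pᵢ≢0 with degree P
... | inj₁ P≡0        = ⊥-elim (Pᵢ≢0 (P≡0 _))
... | inj₂ (d , degP) = d , ℕ.≮⇒≥ (λ d<i → Pᵢ≢0 (Degree.atMost degP _ d<i)) , degP

degreeAtMost-mono : ∀ P {d d′} → d ≤ d′ → DegreeAtMost P d → DegreeAtMost P d′
degreeAtMost-mono P d≤d′ P≤d k d′<k = P≤d k (ℕ.≤-<-trans d≤d′ d′<k)

degreeAtMost-⊕ : ∀ P Q {d} → DegreeAtMost P d → DegreeAtMost Q d → DegreeAtMost (P ⊕ᶻ Q) d
degreeAtMost-⊕ P Q P≤d Q≤d k d<k = trans (coeffᶻ-⊕ P Q k) (cong₂ ℤ._+_ (P≤d k d<k) (Q≤d k d<k))

degreeAtMost-≈scale : ∀ P a P′ {d} → P ≈ᶻ scaleᶻ a P′ → DegreeAtMost P′ d → DegreeAtMost P d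
degreeAtMost-≈scale P a P′ P≈aP′ P′≤d k d<k =
  trans (P≈aP′ k) (trans (coeffᶻ-scale a P′ k) (trans (cong (a ℤ.*_) (P′≤d k d<k)) (ℤ.*-zeroʳ a)))

degreeAtMost-⊗ : ∀ P Q {d e} → DegreeAtMost P d → DegreeAtMost Q e → DegreeAtMost (P ⊗ᶻ Q) (d ℕ.+ e)
degreeAtMost-⊗ P Q {d} {e} P≤d Q≤e n d+e<n = trans (coeffᶻ-⊗ P Q n) (∑≤-zero n term≡0)
  where
  term≡0 : ∀ k → k ≤ n → coeffᶻ P k ℤ.* coeffᶻ Q (n ∸ k) ≡ 0ℤ
  term≡0 k k≤n with d ℕ.<? k
  ... | yes d<k = trans (cong (ℤ._* coeffᶻ Q (n ∸ k)) (P≤d k d<k)) (ℤ.*-zeroˡ (coeffᶻ Q (n ∸ k)))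
  ... | no  d≮k = trans (cong (coeffᶻ P k ℤ.*_) (Q≤e (n ∸ k) e<n∸k)) (ℤ.*-zeroʳ (coeffᶻ P k))
    where
    e<n∸k : e < n ∸ k
    e<n∸k = ℕ.<-≤-trans (subst (_< n ∸ d) (ℕ.m+n∸m≡n d e) (ℕ.∸-monoˡ-< d+e<n (ℕ.m≤m+n d e)))
                        (ℕ.∸-monoʳ-≤ n (ℕ.≮⇒≥ d≮k))

coeffᶻ-⊗-top : ∀ P Q {d e} → DegreeAtMost P d → DegreeAtMost Q e →
               coeffᶻ (P ⊗ᶻ Q) (d ℕ.+ e) ≡ coeffᶻ P d ℤ.* coeffᶻ Q e
coeffᶻ-⊗-top P Q {d} {e} P≤d Q≤e = begin
  coeffᶻ (P ⊗ᶻ Q) (d ℕ.+ e)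
    ≡⟨ coeffᶻ-⊗ P Q (d ℕ.+ e) ⟩
  ∑≤ (d ℕ.+ e) (λ k → coeffᶻ P k ℤ.* coeffᶻ Q (d ℕ.+ e ∸ k))
    ≡⟨ ∑≤-single (d ℕ.+ e) d (ℕ.m≤m+n d e) other≡0 ⟩
  coeffᶻ P d ℤ.* coeffᶻ Q (d ℕ.+ e ∸ d)
    ≡⟨ cong (λ j → coeffᶻ P d ℤ.* coeffᶻ Q j) (ℕ.m+n∸m≡n d e) ⟩
  coeffᶻ P d ℤ.* coeffᶻ Q e ∎
  where
  other≡0 : ∀ k → k ≤ d ℕ.+ e → k ≢ d → coeffᶻ P k ℤ.* coeffᶻ Q (d ℕ.+ e ∸ k) ≡ 0ℤ
  other≡0 k _ k≢d with ℕ.<-cmp k d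
  ... | tri< k<d _ _ = trans (cong (coeffᶻ P k ℤ.*_) (Q≤e _ e<d+e∸k)) (ℤ.*-zeroʳ (coeffᶻ P k))
    where
    e<d+e∸k : e < d ℕ.+ e ∸ k
    e<d+e∸k = subst (_< d ℕ.+ e ∸ k) (ℕ.m+n∸m≡n d e) (ℕ.∸-monoʳ-< k<d (ℕ.m≤m+n d e))
  ... | tri≈ _ k≡d _ = ⊥-elim (k≢d k≡d)
  ... | tri> _ _ d<k =
    trans (cong (ℤ._* coeffᶻ Q (d ℕ.+ e ∸ k)) (P≤d k d<k)) (ℤ.*-zeroˡ (coeffᶻ Q (d ℕ.+ e ∸ k)))

-- Divisibility of coefficients by a prime

euclidsLemma-ℤ : ∀ {p} → Prime p → ∀ a b → + p ∣ a ℤ.* b → + p ∣ a ⊎ + p ∣ b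
euclidsLemma-ℤ p-prime a b p∣ab
  with euclidsLemma ℤ.∣ a ∣ ℤ.∣ b ∣ p-prime (subst (_ ℕ∣.∣_) (ℤ.abs-* a b) (∣⇒∣ᵤ p∣ab))
... | inj₁ p∣a = inj₁ (∣ᵤ⇒∣ p∣a)
... | inj₂ p∣b = inj₂ (∣ᵤ⇒∣ p∣b)

p∤1 : ∀ {p} → Prime p → ¬ (+ p ∣ + 1)
p∤1 p-prime p∣1 = ¬prime[1] (subst Prime (ℕ∣.∣1⇒≡1 (∣⇒∣ᵤ p∣1)) p-prime)

p²∤p : ∀ {p} → Prime p → ¬ (+ p ℤ.* + p ∣ + p)
p²∤p {p} p-prime p²∣p = p∤1 p-prime
  (*-cancelʳ-∣ (+ p) {{prime⇒nonZero p-prime}} (subst (+ p ℤ.* + p ∣_) (sym (ℤ.*-identityˡ (+ p))) p²∣p))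

p²∤ab : ∀ {p} → Prime p → ∀ {a b} → ¬ (+ p ∣ a) → ¬ (+ p ℤ.* + p ∣ b) → ¬ (+ p ℤ.* + p ∣ a ℤ.* b)
p²∤ab {p} p-prime {a} {b} p∤a p²∤b p²∣ab
  with euclidsLemma-ℤ p-prime a b (∣-trans (∣n⇒∣m*n (+ p) ∣-refl) p²∣ab)
... | inj₁ p∣a = p∤a p∣a
... | inj₂ (divides q refl) with euclidsLemma-ℤ p-prime a q p∣aq
  where
  p∣aq : + p ∣ a ℤ.* q
  p∣aq = *-cancelʳ-∣ (+ p) {{prime⇒nonZero p-prime}}
           (subst (+ p ℤ.* + p ∣_) (sym (ℤ.*-assoc a q (+ p))) p²∣ab)
...   | inj₁ p∣a = p∤a p∣a
...   | inj₂ p∣q = p²∤b (*-monoˡ-∣ (+ p) p∣q)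

nonMultiple⇒≢0 : ∀ {p a} → ¬ (+ p ∣ a) → a ≢ 0ℤ
nonMultiple⇒≢0 p∤a refl = p∤a (divides 0ℤ refl)

infix 4 _∣ₚ_

_∣ₚ_ : ℤ → Polyᶻ → Set
a ∣ₚ P = ∀ k → a ∣ coeffᶻ P k

∣ₚ-⊗ : ∀ {a} P Q → a ∣ₚ P ⊎ a ∣ₚ Q → a ∣ₚ P ⊗ᶻ Q
∣ₚ-⊗ {a} P Q a∣P⊎a∣Q n = subst (a ∣_) (sym (coeffᶻ-⊗ P Q n)) (∑≤-∣ n term)
  where
  term : ∀ k → k ≤ n → a ∣ coeffᶻ P k ℤ.* coeffᶻ Q (n ∸ k)
  term k _ = [ (λ a∣P → ∣m⇒∣m*n (coeffᶻ Q (n ∸ k)) (a∣P k)) ,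
               (λ a∣Q → ∣n⇒∣m*n (coeffᶻ P k) (a∣Q (n ∸ k))) ] a∣P⊎a∣Q

∣ₚ⇒≈scale : ∀ {a} P → a ∣ₚ P → ∃[ P′ ] P ≈ᶻ scaleᶻ a P′
∣ₚ⇒≈scale []          _    = [] , λ _ → refl
∣ₚ⇒≈scale {a} (b ∷ P) a∣bP with ∣ₚ⇒≈scale P (λ k → a∣bP (suc k))
... | P′ , P≈aP′ = _∣_.quotient (a∣bP 0) ∷ P′ , λ
  { zero    → trans (_∣_.equality (a∣bP 0)) (ℤ.*-comm _ a)
  ; (suc k) → P≈aP′ k }

record LowestNonMultiple (p : ℕ) (P : Polyᶻ) (i : ℕ) : Set where
  field
    nonMultiple   : ¬ (+ p ∣ coeffᶻ P i)
    multipleBelow : ∀ k → k < i → + p ∣ coeffᶻ P k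

lowestNonMultiple : ∀ p P → + p ∣ₚ P ⊎ ∃ (LowestNonMultiple p P)
lowestNonMultiple p []      = inj₁ (λ _ → divides 0ℤ refl)
lowestNonMultiple p (a ∷ P) with + p ∣? a
... | no  p∤a = inj₂ (0 , record { nonMultiple = p∤a ; multipleBelow = λ _ () })
... | yes p∣a with lowestNonMultiple p P
...   | inj₁ p∣P       = inj₁ λ { zero → p∣a ; (suc k) → p∣P k }
...   | inj₂ (i , low) = inj₂ (suc i , record
  { nonMultiple   = LowestNonMultiple.nonMultiple low
  ; multipleBelow = λ { zero _ → p∣a ; (suc k) (s≤s k<i) → LowestNonMultiple.multipleBelow low k k<i } })

coeffᶻ-⊗-lowest : ∀ {p P Q i j} → Prime p → LowestNonMultiple p P i → LowestNonMultiple p Q j →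
                  ¬ (+ p ∣ coeffᶻ (P ⊗ᶻ Q) (i ℕ.+ j))
coeffᶻ-⊗-lowest {p} {P} {Q} {i} {j} p-prime lowP lowQ p∣PQ
  with euclidsLemma-ℤ p-prime (coeffᶻ P i) (coeffᶻ Q j) p∣PᵢQⱼ
  where
  other : ∀ k → k ≤ i ℕ.+ j → k ≢ i → + p ∣ coeffᶻ P k ℤ.* coeffᶻ Q (i ℕ.+ j ∸ k)
  other k k≤i+j k≢i with ℕ.<-cmp k i
  ... | tri< k<i _ _ = ∣m⇒∣m*n (coeffᶻ Q (i ℕ.+ j ∸ k)) (LowestNonMultiple.multipleBelow lowP k k<i)
  ... | tri≈ _ k≡i _ = ⊥-elim (k≢i k≡i)
  ... | tri> _ _ i<k = ∣n⇒∣m*n (coeffᶻ P k) (LowestNonMultiple.multipleBelow lowQ _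
          (subst (i ℕ.+ j ∸ k <_) (ℕ.m+n∸m≡n i j) (ℕ.∸-monoʳ-< i<k k≤i+j)))
  p∣PᵢQⱼ : + p ∣ coeffᶻ P i ℤ.* coeffᶻ Q j
  p∣PᵢQⱼ = subst (λ m → + p ∣ coeffᶻ P i ℤ.* coeffᶻ Q m) (ℕ.m+n∸m≡n i j)
             (∑≤-∣-single (i ℕ.+ j) i (ℕ.m≤m+n i j) other (subst (+ p ∣_) (coeffᶻ-⊗ P Q (i ℕ.+ j)) p∣PQ))
... | inj₁ p∣Pᵢ = LowestNonMultiple.nonMultiple lowP p∣Pᵢ
... | inj₂ p∣Qⱼ = LowestNonMultiple.nonMultiple lowQ p∣Qⱼ

gauss : ∀ {p} → Prime p → ∀ P Q → + p ∣ₚ P ⊗ᶻ Q → + p ∣ₚ P ⊎ + p ∣ₚ Q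
gauss {p} p-prime P Q p∣PQ with lowestNonMultiple p P | lowestNonMultiple p Q
... | inj₁ p∣P        | _               = inj₁ p∣P
... | inj₂ _          | inj₁ p∣Q        = inj₂ p∣Q
... | inj₂ (i , lowP) | inj₂ (j , lowQ) = ⊥-elim (coeffᶻ-⊗-lowest p-prime lowP lowQ (p∣PQ (i ℕ.+ j)))

-- Eisenstein's criterion

record Eisenstein (p n : ℕ) (H : Polyᶻ) : Set where
  field
    prime       : Prime p
    p∤leading   : ¬ (+ p ∣ coeffᶻ H n)
    p∣lower     : ∀ k → k < n → + p ∣ coeffᶻ H k
    p²∤constant : ¬ (+ p ℤ.* + p ∣ coeffᶻ H 0)
    degree≤     : DegreeAtMost H n

eisenstein-scale : ∀ {p n H} a → Eisenstein p n H → ¬ (+ p ∣ a) → Eisenstein p n (scaleᶻ a H)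
eisenstein-scale {p} {n} {H} a eis p∤a = record
  { prime       = prime
  ; p∤leading   = [ p∤a , p∤leading ] ∘ euclidsLemma-ℤ prime a (coeffᶻ H n)
                    ∘ subst (+ p ∣_) (coeffᶻ-scale a H n)
  ; p∣lower     = λ k k<n → subst (+ p ∣_) (sym (coeffᶻ-scale a H k)) (∣n⇒∣m*n a (p∣lower k k<n))
  ; p²∤constant = p²∤ab prime p∤a p²∤constant ∘ subst (+ p ℤ.* + p ∣_) (coeffᶻ-scale a H 0)
  ; degree≤     = degreeAtMost-≈scale (scaleᶻ a H) a H (λ _ → refl) degree≤
  }
  where open Eisenstein eis

+-squeeze : ∀ {i j d e} → i ≤ d → j ≤ e → d ℕ.+ e ≤ i ℕ.+ j → d ≤ i × e ≤ j
+-squeeze {i} {j} {d} {e} i≤d j≤e d+e≤i+j =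
  ℕ.+-cancelʳ-≤ j d i (ℕ.≤-trans (ℕ.+-monoʳ-≤ d j≤e) d+e≤i+j) ,
  ℕ.+-cancelˡ-≤ i e j (ℕ.≤-trans (ℕ.+-monoˡ-≤ e i≤d) d+e≤i+j)

-- Let i, j be the lowest indices of coefficients of F, G prime to p, and d, e their
-- degrees. Then i + j ≥ n (coeffᶻ-⊗-lowest) and d + e ≤ n (coeffᶻ-⊗-top), while i ≤ d and
-- j ≤ e; hence d = i and e = j, and one of them is 0, for otherwise p would divide both
-- F₀ and G₀ and p² would divide H₀.
module _ {p n H} (eis : Eisenstein p n H) (F G : Polyᶻ) (FG≈H : F ⊗ᶻ G ≈ᶻ H) where
  open Eisenstein eis

  private
    lowest : ∀ P → (+ p ∣ₚ P → + p ∣ₚ F ⊗ᶻ G) → ∃ (LowestNonMultiple p P)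
    lowest P p∣P⇒p∣FG with lowestNonMultiple p P
    ... | inj₁ p∣P = ⊥-elim (p∤leading (subst (+ p ∣_) (FG≈H n) (p∣P⇒p∣FG p∣P n)))
    ... | inj₂ low = low

    n≤i+j : ∀ {i j} → LowestNonMultiple p F i → LowestNonMultiple p G j → n ≤ i ℕ.+ j
    n≤i+j lowF lowG = ℕ.≮⇒≥ λ i+j<n →
      coeffᶻ-⊗-lowest prime lowF lowG (subst (+ p ∣_) (sym (FG≈H _)) (p∣lower _ i+j<n))

    d+e≤n : ∀ {d e} → Degree F d → Degree G e → d ℕ.+ e ≤ n
    d+e≤n {d} {e} degF degG = ℕ.≮⇒≥ λ n<d+e →
      [ Degree.leading≢0 degF , Degree.leading≢0 degG ]
        (ℤ.i*j≡0⇒i≡0∨j≡0 (coeffᶻ F d) (begin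
          coeffᶻ F d ℤ.* coeffᶻ G e   ≡⟨ coeffᶻ-⊗-top F G (Degree.atMost degF) (Degree.atMost degG) ⟨
          coeffᶻ (F ⊗ᶻ G) (d ℕ.+ e)   ≡⟨ FG≈H (d ℕ.+ e) ⟩
          coeffᶻ H (d ℕ.+ e)          ≡⟨ degree≤ _ n<d+e ⟩
          0ℤ                          ∎))

    constantFactor : ∀ {i j d e} → LowestNonMultiple p F i → LowestNonMultiple p G j →
                     Degree F d → Degree G e → d ≤ i → e ≤ j → DegreeAtMost F 0 ⊎ DegreeAtMost G 0
    constantFactor {zero}          _ _ degF _    d≤0 _   = inj₁ (degreeAtMost-mono F d≤0 (Degree.atMost degF))
    constantFactor {suc _} {zero}  _ _ _    degG _   e≤0 = inj₂ (degreeAtMost-mono G e≤0 (Degree.atMost degG))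
    constantFactor {suc _} {suc _} lowF lowG _ _ _ _ =
      ⊥-elim (p²∤constant (subst (+ p ℤ.* + p ∣_) (trans (sym (coeffᶻ-⊗ F G 0)) (FG≈H 0))
        (∣-trans {+ p ℤ.* + p} {coeffᶻ F 0 ℤ.* + p} (*-monoˡ-∣ (+ p) p∣F₀) (*-monoʳ-∣ (coeffᶻ F 0) p∣G₀))))
      where
      p∣F₀ : + p ∣ coeffᶻ F 0
      p∣F₀ = LowestNonMultiple.multipleBelow lowF 0 (s≤s z≤n)
      p∣G₀ : + p ∣ coeffᶻ G 0
      p∣G₀ = LowestNonMultiple.multipleBelow lowG 0 (s≤s z≤n)

  eisenstein-⊗ : DegreeAtMost F 0 ⊎ DegreeAtMost G 0
  eisenstein-⊗ with lowest F (∣ₚ-⊗ F G ∘ inj₁) | lowest G (∣ₚ-⊗ F G ∘ inj₂)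
  ... | i , lowF | j , lowG
    with degree≥ F (nonMultiple⇒≢0 (LowestNonMultiple.nonMultiple lowF))
       | degree≥ G (nonMultiple⇒≢0 (LowestNonMultiple.nonMultiple lowG))
  ... | d , i≤d , degF | e , j≤e , degG
    with +-squeeze i≤d j≤e (ℕ.≤-trans (d+e≤n degF degG) (n≤i+j lowF lowG))
  ... | d≤i , e≤j = constantFactor lowF lowG degF degG d≤i e≤j

-- Gauss's lemma moves each factor p of D into F or G, until p ∤ D and D·H is Eisenstein.
eisenstein-⊗-scaled : ∀ {p n H} → Eisenstein p n H → ∀ {D} → Acc _<_ D → .{{ℕ.NonZero D}} →
                      ∀ F G → F ⊗ᶻ G ≈ᶻ scaleᶻ (+ D) H → DegreeAtMost F 0 ⊎ DegreeAtMost G 0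
eisenstein-⊗-scaled {p} {n} {H} eis {D} (acc smaller) F G FG≈DH with p ℕ∣.∣? D
... | no  p∤D = eisenstein-⊗ (eisenstein-scale (+ D) eis (p∤D ∘ ∣⇒∣ᵤ)) F G FG≈DH
... | yes p∣D = [ peel F G FG≈DH , Sum.swap ∘ peel G F GF≈DH ] (gauss prime F G p∣FG)
  where
  open Eisenstein eis
  q = ℕ∣.quotient p∣D
  instance
    _ = prime⇒nonZero prime
    _ = prime⇒nonTrivial prime
    _ = ℕ∣.quotient≢0 p∣D

  D≡p*q : + D ≡ + p ℤ.* + q
  D≡p*q = trans (cong +_ (ℕ∣.m∣n⇒n≡m*quotient p∣D)) (ℤ.pos-* p q)

  p∣FG : + p ∣ₚ F ⊗ᶻ G
  p∣FG k = subst (+ p ∣_) (sym (trans (FG≈DH k) (coeffᶻ-scale (+ D) H k)))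
                 (∣m⇒∣m*n (coeffᶻ H k) (subst (+ p ∣_) (sym D≡p*q) (∣m⇒∣m*n (+ q) ∣-refl)))

  GF≈DH : G ⊗ᶻ F ≈ᶻ scaleᶻ (+ D) H
  GF≈DH k = trans (⊗ᶻ-comm G F k) (FG≈DH k)

  peel : ∀ P Q → P ⊗ᶻ Q ≈ᶻ scaleᶻ (+ D) H → + p ∣ₚ P → DegreeAtMost P 0 ⊎ DegreeAtMost Q 0
  peel P Q PQ≈DH p∣P with ∣ₚ⇒≈scale P p∣P
  ... | P′ , P≈pP′ = Sum.map₁ (degreeAtMost-≈scale P (+ p) P′ P≈pP′)
                       (eisenstein-⊗-scaled eis (smaller (ℕ∣.quotient-< p∣D)) P′ Q P′Q≈qH)
    where
    P′Q≈qH : P′ ⊗ᶻ Q ≈ᶻ scaleᶻ (+ q) H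
    P′Q≈qH k = ℤ.*-cancelˡ-≡ (+ p) (coeffᶻ (P′ ⊗ᶻ Q) k) (coeffᶻ (scaleᶻ (+ q) H) k) (begin
      + p ℤ.* coeffᶻ (P′ ⊗ᶻ Q) k          ≡⟨ coeffᶻ-scale (+ p) (P′ ⊗ᶻ Q) k ⟨
      coeffᶻ (scaleᶻ (+ p) (P′ ⊗ᶻ Q)) k   ≡⟨ ⊗ᶻ-≈scaleˡ (+ p) P P′ Q P≈pP′ k ⟨
      coeffᶻ (P ⊗ᶻ Q) k                   ≡⟨ trans (PQ≈DH k) (coeffᶻ-scale (+ D) H k) ⟩
      + D ℤ.* coeffᶻ H k                  ≡⟨ cong (ℤ._* coeffᶻ H k) D≡p*q ⟩
      + p ℤ.* + q ℤ.* coeffᶻ H k          ≡⟨ ℤ.*-assoc (+ p) (+ q) (coeffᶻ H k) ⟩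
      + p ℤ.* (+ q ℤ.* coeffᶻ H k)        ≡⟨ cong (+ p ℤ.*_) (coeffᶻ-scale (+ q) H k) ⟨
      + p ℤ.* coeffᶻ (scaleᶻ (+ q) H) k   ∎)

clearDenominators : ∀ f → ∃₂ λ d F → map fromℤ F ≡ scale (fromℤ (+ suc d)) f
clearDenominators []                  = 0 , [] , refl
clearDenominators (q@(mkℚ m e _) ∷ f) with clearDenominators f
... | d , F , F≡δf = d ℕ.+ e ℕ.* suc d , m ℤ.* + suc d ∷ scaleᶻ (+ suc e) F , cong₂ _∷_ head tail
  where
  δ = fromℤ (+ suc d)
  ε = fromℤ (+ suc e)
  head : fromℤ (m ℤ.* + suc d) ≡ fromℤ (+ (suc e ℕ.* suc d)) ℚ.* q
  head = begin
    fromℤ (m ℤ.* + suc d)              ≡⟨ fromℤ-* m (+ suc d) ⟩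
    fromℤ m ℚ.* δ                      ≡⟨ cong (ℚ._* δ) (fromℤ-↧*≡↥ q) ⟨
    ε ℚ.* q ℚ.* δ                      ≡⟨ ℚ.*-assoc ε q δ ⟩
    ε ℚ.* (q ℚ.* δ)                    ≡⟨ cong (ε ℚ.*_) (ℚ.*-comm q δ) ⟩
    ε ℚ.* (δ ℚ.* q)                    ≡⟨ ℚ.*-assoc ε δ q ⟨
    ε ℚ.* δ ℚ.* q                      ≡⟨ cong (ℚ._* q) (fromℤ-pos-* (suc e) (suc d)) ⟨
    fromℤ (+ (suc e ℕ.* suc d)) ℚ.* q  ∎
  tail : map fromℤ (scaleᶻ (+ suc e) F) ≡ scale (fromℤ (+ (suc e ℕ.* suc d))) f
  tail = begin
    map fromℤ (scaleᶻ (+ suc e) F)         ≡⟨ map-fromℤ-scale (+ suc e) F ⟩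
    scale ε (map fromℤ F)                  ≡⟨ cong (scale ε) F≡δf ⟩
    scale ε (scale δ f)                    ≡⟨ scale-scale ε δ f ⟩
    scale (ε ℚ.* δ) f                      ≡⟨ cong (λ c → scale c f) (fromℤ-pos-* (suc e) (suc d)) ⟨
    scale (fromℤ (+ (suc e ℕ.* suc d))) f  ∎

cleared-⊗ : ∀ {a b f g F G} H → map fromℤ F ≡ scale (fromℤ (+ a)) f → map fromℤ G ≡ scale (fromℤ (+ b)) g →
            (f ⊗ g) ≈ₚ map fromℤ H → F ⊗ᶻ G ≈ᶻ scaleᶻ (+ (a ℕ.* b)) H
cleared-⊗ {a} {b} {f} {g} {F} {G} H F≡αf G≡βg fg≈H k = fromℤ-injective (begin
  fromℤ (coeffᶻ (F ⊗ᶻ G) k)                   ≡⟨ coeff-map-fromℤ (F ⊗ᶻ G) k ⟨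
  coeff (map fromℤ (F ⊗ᶻ G)) k                ≡⟨ cong (λ P → coeff P k) (map-fromℤ-⊗ F G) ⟩
  coeff (map fromℤ F ⊗ map fromℤ G) k         ≡⟨ cong₂ (λ P Q → coeff (P ⊗ Q) k) F≡αf G≡βg ⟩
  coeff (scale α f ⊗ scale β g) k             ≡⟨ cong (λ P → coeff P k) (scale-⊗-scale α β f g) ⟩
  coeff (scale (α ℚ.* β) (f ⊗ g)) k           ≡⟨ coeff-scale (α ℚ.* β) (f ⊗ g) k ⟩
  α ℚ.* β ℚ.* coeff (f ⊗ g) k                 ≡⟨ cong₂ ℚ._*_ (sym (fromℤ-pos-* a b))
                                                              (trans (fg≈H k) (coeff-map-fromℤ H k)) ⟩
  fromℤ (+ (a ℕ.* b)) ℚ.* fromℤ (coeffᶻ H k)  ≡⟨ fromℤ-* (+ (a ℕ.* b)) (coeffᶻ H k) ⟨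
  fromℤ (+ (a ℕ.* b) ℤ.* coeffᶻ H k)          ≡⟨ cong fromℤ (coeffᶻ-scale (+ (a ℕ.* b)) H k) ⟨
  fromℤ (coeffᶻ (scaleᶻ (+ (a ℕ.* b)) H) k)   ∎)
  where
  α = fromℤ (+ a)
  β = fromℤ (+ b)

cleared-constant : ∀ {d f F} → map fromℤ F ≡ scale (fromℤ (+ suc d)) f → DegreeAtMost F 0 → IsConstant f
cleared-constant {d} {f} {F} F≡δf F≤0 k = a*x≡0⇒x≡0 δ (begin
  δ ℚ.* coeff f (suc k)          ≡⟨ coeff-scale δ f (suc k) ⟨
  coeff (scale δ f) (suc k)      ≡⟨ cong (λ P → coeff P (suc k)) F≡δf ⟨
  coeff (map fromℤ F) (suc k)    ≡⟨ coeff-map-fromℤ F (suc k) ⟩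
  fromℤ (coeffᶻ F (suc k))       ≡⟨ cong fromℤ (F≤0 (suc k) (s≤s z≤n)) ⟩
  0ℚ                             ∎)
  where
  δ = fromℤ (+ suc d)

eisenstein⇒irreducible : ∀ {p n H} → Eisenstein p (suc n) H → Irreducible (map fromℤ H)
eisenstein⇒irreducible {p} {n} {H} eis = nonConstant , factors
  where
  open Eisenstein eis
  nonConstant : ¬ IsConstant (map fromℤ H)
  nonConstant H-constant = nonMultiple⇒≢0 p∤leading
    (fromℤ-injective (trans (sym (coeff-map-fromℤ H (suc n))) (H-constant n)))
  factors : ∀ f g → (f ⊗ g) ≈ₚ map fromℤ H → IsConstant f ⊎ IsConstant g
  factors f g fg≈H with clearDenominators f | clearDenominators g
  ... | a , F , F≡αf | b , G , G≡βg =
    Sum.map (cleared-constant F≡αf) (cleared-constant G≡βg)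
      (eisenstein-⊗-scaled eis (<-wellFounded (suc a ℕ.* suc b)) F G (cleared-⊗ H F≡αf G≡βg fg≈H))

-- The polynomials C_v

degreeAtMost-Xpow+aXQ+a : ∀ {m} a Q → DegreeAtMost Q m →
                          DegreeAtMost (Xpowᶻ (suc m) ⊕ᶻ scaleᶻ a (Xᶻ ⊗ᶻ Q) ⊕ᶻ constᶻ a) (suc m)
degreeAtMost-Xpow+aXQ+a {m} a Q Q≤m =
  degreeAtMost-⊕ (Xpowᶻ (suc m) ⊕ᶻ scaleᶻ a (Xᶻ ⊗ᶻ Q)) (constᶻ a)
    (degreeAtMost-⊕ (Xpowᶻ (suc m)) (scaleᶻ a (Xᶻ ⊗ᶻ Q))
      (λ k m<k → coeffᶻ-Xpow-≢ (suc m) k (ℕ.>⇒≢ m<k))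
      (degreeAtMost-≈scale (scaleᶻ a (Xᶻ ⊗ᶻ Q)) a (Xᶻ ⊗ᶻ Q) (λ _ → refl) (degreeAtMost-⊗ Xᶻ Q X≤1 Q≤m)))
    (λ { (suc k) _ → refl })
  where
  X≤1 : DegreeAtMost Xᶻ 1
  X≤1 (suc zero)    (s≤s ())
  X≤1 (suc (suc k)) _ = refl

eisenstein-X+p : ∀ {p} → Prime p → Eisenstein p 1 (Xᶻ ⊕ᶻ constᶻ (+ p))
eisenstein-X+p p-prime = record
  { prime       = p-prime
  ; p∤leading   = p∤1 p-prime
  ; p∣lower     = λ { zero _ → ∣-refl ; (suc _) (s≤s ()) }
  ; p²∤constant = p²∤p p-prime
  ; degree≤     = λ { (suc zero) (s≤s ()) ; (suc (suc k)) _ → refl }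
  }

eisenstein-Xpow+pXQ+p : ∀ {p m} Q → Prime p → DegreeAtMost Q m →
                        Eisenstein p (suc m) (Xpowᶻ (suc m) ⊕ᶻ scaleᶻ (+ p) (Xᶻ ⊗ᶻ Q) ⊕ᶻ constᶻ (+ p))
eisenstein-Xpow+pXQ+p {p} {m} Q p-prime Q≤m = record
  { prime       = p-prime
  ; p∤leading   = p∤Eₙ
  ; p∣lower     = p∣Eₖ
  ; p²∤constant = p²∤p p-prime ∘ subst (+ p ℤ.* + p ∣_) E₀≡p
  ; degree≤     = degreeAtMost-Xpow+aXQ+a (+ p) Q Q≤m
  }
  where
  E = Xpowᶻ (suc m) ⊕ᶻ scaleᶻ (+ p) (Xᶻ ⊗ᶻ Q) ⊕ᶻ constᶻ (+ p)

  coeff-E : ∀ k → coeffᶻ E k ≡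
                  coeffᶻ (Xpowᶻ (suc m)) k ℤ.+ + p ℤ.* coeffᶻ (Xᶻ ⊗ᶻ Q) k ℤ.+ coeffᶻ (constᶻ (+ p)) k
  coeff-E k = trans (coeffᶻ-⊕ (Xpowᶻ (suc m) ⊕ᶻ scaleᶻ (+ p) (Xᶻ ⊗ᶻ Q)) (constᶻ (+ p)) k)
    (cong (ℤ._+ coeffᶻ (constᶻ (+ p)) k) (trans (coeffᶻ-⊕ (Xpowᶻ (suc m)) (scaleᶻ (+ p) (Xᶻ ⊗ᶻ Q)) k)
      (cong (λ x → coeffᶻ (Xpowᶻ (suc m)) k ℤ.+ x) (coeffᶻ-scale (+ p) (Xᶻ ⊗ᶻ Q) k))))

  E₀≡p : coeffᶻ E 0 ≡ + p
  E₀≡p = begin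
    coeffᶻ E 0                                   ≡⟨ coeff-E 0 ⟩
    + 0 ℤ.+ + p ℤ.* coeffᶻ (Xᶻ ⊗ᶻ Q) 0 ℤ.+ + p   ≡⟨ cong (λ x → + 0 ℤ.+ + p ℤ.* x ℤ.+ + p) (coeffᶻ-X⊗-zero Q) ⟩
    + 0 ℤ.+ + p ℤ.* 0ℤ ℤ.+ + p                   ≡⟨ cong (λ x → + 0 ℤ.+ x ℤ.+ + p) (ℤ.*-zeroʳ (+ p)) ⟩
    + p                                          ∎

  p∤Eₙ : ¬ (+ p ∣ coeffᶻ E (suc m))
  p∤Eₙ p∣Eₙ = p∤1 p-prime (∣m+n∣n⇒∣m (∣m+n∣n⇒∣m p∣1+pXQ+0 (divides 0ℤ refl)) (∣m⇒∣m*n _ ∣-refl))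
    where
    pXQ = + p ℤ.* coeffᶻ (Xᶻ ⊗ᶻ Q) (suc m)
    p∣1+pXQ+0 : + p ∣ + 1 ℤ.+ pXQ ℤ.+ 0ℤ
    p∣1+pXQ+0 = subst (+ p ∣_) (trans (coeff-E (suc m)) (cong (λ x → x ℤ.+ pXQ ℤ.+ 0ℤ) (coeffᶻ-Xpow-≡ (suc m))))
                      p∣Eₙ

  p∣Eₖ : ∀ k → k < suc m → + p ∣ coeffᶻ E k
  p∣Eₖ k k<n = subst (+ p ∣_) (sym (coeff-E k)) (∣m∣n⇒∣m+n (∣m∣n⇒∣m+n p∣Xpow (∣m⇒∣m*n _ ∣-refl)) (p∣const k))
    where
    p∣Xpow : + p ∣ coeffᶻ (Xpowᶻ (suc m)) k
    p∣Xpow = subst (+ p ∣_) (sym (coeffᶻ-Xpow-≢ (suc m) k (ℕ.<⇒≢ k<n))) (divides 0ℤ refl)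
    p∣const : ∀ k → + p ∣ coeffᶻ (constᶻ (+ p)) k
    p∣const zero    = ∣-refl
    p∣const (suc k) = divides 0ℤ refl

mutual
  degreeAtMost-Cᶻ : ∀ S → DegreeAtMost (Cᶻ S) (size S)
  degreeAtMost-Cᶻ (node l [])       (suc zero)    (s≤s ())
  degreeAtMost-Cᶻ (node l [])       (suc (suc k)) _ = refl
  degreeAtMost-Cᶻ (node l (c ∷ cs)) =
    degreeAtMost-Xpow+aXQ+a (+ nthPrime l) (prodCᶻ (c ∷ cs)) (degreeAtMost-prodCᶻ (c ∷ cs))

  degreeAtMost-prodCᶻ : ∀ cs → DegreeAtMost (prodCᶻ cs) (sizes cs)
  degreeAtMost-prodCᶻ []       (suc k) _ = refl
  degreeAtMost-prodCᶻ (c ∷ cs) =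
    degreeAtMost-⊗ (Cᶻ c) (prodCᶻ cs) (degreeAtMost-Cᶻ c) (degreeAtMost-prodCᶻ cs)

Cᶻ-eisenstein : ∀ l cs → Prime (nthPrime l) → Eisenstein (nthPrime l) (size (node l cs)) (Cᶻ (node l cs))
Cᶻ-eisenstein l []       p-prime = eisenstein-X+p p-prime
Cᶻ-eisenstein l (c ∷ cs) p-prime =
  eisenstein-Xpow+pXQ+p (prodCᶻ (c ∷ cs)) p-prime (degreeAtMost-prodCᶻ (c ∷ cs))

mutual
  ⊑-labelsPos : ∀ {S T} → S ⊑ T → LabelsPos T → LabelsPos S
  ⊑-labelsPos here       T-labels           = T-labels
  ⊑-labelsPos (there S∈) (node _ cs-labels) = any-⊑-labelsPos S∈ cs-labels

  any-⊑-labelsPos : ∀ {S cs} → Any (S ⊑_) cs → All LabelsPos cs → LabelsPos S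
  any-⊑-labelsPos (here S⊑c) (c-labels ∷ _)  = ⊑-labelsPos S⊑c c-labels
  any-⊑-labelsPos (there S∈) (_ ∷ cs-labels) = any-⊑-labelsPos S∈ cs-labels

mainTheorem4 : (T : Tree) → LabelsPos T → (S : Tree) → S ⊑ T → Irreducible (C S)
mainTheorem4 T T-labels S S⊑T with ⊑-labelsPos S⊑T T-labels
... | node {suc l} {cs} _ _ =
  subst Irreducible (map-fromℤ-C (node (suc l) cs))
    (eisenstein⇒irreducible (Cᶻ-eisenstein (suc l) cs (nthPrime-prime l)))
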